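{- There is an interpretation $(\mathcal{M}_{IPC},\varepsilon)$ such that for all $\varphi\in Fm_0$: $(\mathcal{M}_{IPC},\varepsilon)\vDash\square\varphi\iff\ \vdash_{IPC}\varphi$ (i.e. $\varphi$ is a theorem of intuitionistic propositional logic).
   Context: $Fm$ is the set of formulas generated from an infinite set $V$ of propositional variables by $\bot$, binary $\rightarrow,\vee,\wedge$ and unary $\square$; $Fm_0$ is the set of formulas without $\square$. Semantics: a Heyting algebra $(M,f_\top,f_\bot,f_\vee,f_\wedge,f_\rightarrow)$ is a bounded lattice (top $f_\top$, bottom $f_\bot$, order $\le$) with $f_\rightarrow(m,m')$ the greatest $m''$ with $f_\wedge(m,m'')\le m'$; a filter is a non-empty upward closed $F\subseteq M$ closed under $f_\wedge$ with $f_\bot\notin F$; an ultrafilter is a maximal filter. A model $\mathcal{M}=(M,\mathit{TRUE},f_\top,f_\bot,f_\rightarrow,f_\vee,f_\wedge,f_\square)$ is a Heyting algebra with an ultrafilter $\mathit{TRUE}$ and unary $f_\square$ such that for all $m,m',m''$: (1) $f_\square(m)\le m$; (2) $f_\square(f_\rightarrow(m,m'))\le f_\rightarrow(f_\square(f_\rightarrow(m',m'')),f_\square(f_\rightarrow(m,m'')))$; (3) $f_\square(f_\vee(m,m'))\le f_\vee(f_\square(m),f_\square(m'))$; (4) $f_\square(m)\in\mathit{TRUE}\iff m=f_\top$. An assignment $\varepsilon:V\to M$ extends homomorphically to $Fm$ ($\varepsilon(\bot)=f_\bot$, $\varepsilon(\square\varphi)=f_\square(\varepsilon(\varphi))$,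 $\varepsilon(\varphi*\psi)=f_*(\varepsilon(\varphi),\varepsilon(\psi))$). An interpretation is a pair $(\mathcal{M},\varepsilon)$; $(\mathcal{M},\varepsilon)\vDash\varphi$ iff $\varepsilon(\varphi)\in\mathit{TRUE}$. -}

module Defs where

open import Level using (Level; _⊔_) renaming (suc to lsuc)
open import Data.Nat using (ℕ)
open import Data.Product using (Σ; _×_; ∃)
open import Relation.Nullary using (¬_)
open import Relation.Unary using (Pred; _∈_; _∉_; _⊆_)
open import Relation.Binary.Lattice.Bundles using (HeytingAlgebra)

V : Set
V = ℕ

infixr 5 _⇒_
infixr 6 _∨ᶠ_
infixr 7 _∧ᶠ_

data Fm : Set where
  var  : V → Fm
  ⊥ᶠ   : Fm
  _⇒_  : Fm → Fm → Fm
  _∨ᶠ_ : Fm → Fm → Fm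
  _∧ᶠ_ : Fm → Fm → Fm
  □_   : Fm → Fm

data Fm₀ : Set where
  var  : V → Fm₀
  ⊥ᶠ   : Fm₀
  _⇒_  : Fm₀ → Fm₀ → Fm₀
  _∨ᶠ_ : Fm₀ → Fm₀ → Fm₀
  _∧ᶠ_ : Fm₀ → Fm₀ → Fm₀

⌜_⌝ : Fm₀ → Fm
⌜ var x ⌝    = var x
⌜ ⊥ᶠ ⌝       = ⊥ᶠ
⌜ φ ⇒ ψ ⌝    = ⌜ φ ⌝ ⇒ ⌜ ψ ⌝
⌜ φ ∨ᶠ ψ ⌝   = ⌜ φ ⌝ ∨ᶠ ⌜ ψ ⌝
⌜ φ ∧ᶠ ψ ⌝   = ⌜ φ ⌝ ∧ᶠ ⌜ ψ ⌝

infix 3 ⊢IPC_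

data ⊢IPC_ : Fm₀ → Set where
  ax-K   : ∀ {φ ψ}   → ⊢IPC φ ⇒ (ψ ⇒ φ)
  ax-S   : ∀ {φ ψ χ} → ⊢IPC (φ ⇒ (ψ ⇒ χ)) ⇒ ((φ ⇒ ψ) ⇒ (φ ⇒ χ))
  ax-∧I  : ∀ {φ ψ}   → ⊢IPC φ ⇒ (ψ ⇒ (φ ∧ᶠ ψ))
  ax-∧E₁ : ∀ {φ ψ}   → ⊢IPC (φ ∧ᶠ ψ) ⇒ φ
  ax-∧E₂ : ∀ {φ ψ}   → ⊢IPC (φ ∧ᶠ ψ) ⇒ ψ
  ax-∨I₁ : ∀ {φ ψ}   → ⊢IPC φ ⇒ (φ ∨ᶠ ψ)
  ax-∨I₂ : ∀ {φ ψ}   → ⊢IPC ψ ⇒ (φ ∨ᶠ ψ)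
  ax-∨E  : ∀ {φ ψ χ} → ⊢IPC (φ ⇒ χ) ⇒ ((ψ ⇒ χ) ⇒ ((φ ∨ᶠ ψ) ⇒ χ))
  ax-⊥E  : ∀ {φ}     → ⊢IPC ⊥ᶠ ⇒ φ
  mp     : ∀ {φ ψ}   → ⊢IPC φ ⇒ ψ → ⊢IPC φ → ⊢IPC ψ

module _ {c ℓ₁ ℓ₂ : Level} (H : HeytingAlgebra c ℓ₁ ℓ₂) where
  open HeytingAlgebra H

  record IsFilter {ℓ : Level} (F : Pred Carrier ℓ) : Set (c ⊔ ℓ ⊔ ℓ₂) where
    field
      nonEmpty    : ∃ λ m → m ∈ F
      upClosed    : ∀ {m m′} → m ≤ m′ → m ∈ F → m′ ∈ F
      ∧-closed    : ∀ {m m′} → m ∈ F → m′ ∈ F → (m ∧ m′) ∈ F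
      ⊥∉          : ⊥ ∉ F

  record IsUltrafilter {ℓ : Level} (F : Pred Carrier ℓ) : Set (c ⊔ lsuc ℓ ⊔ ℓ₂) where
    field
      isFilter : IsFilter F
      maximal  : ∀ (G : Pred Carrier ℓ) → IsFilter G → F ⊆ G → G ⊆ F

record Model (c ℓ₁ ℓ₂ ℓ : Level) : Set (lsuc (c ⊔ ℓ₁ ⊔ ℓ₂ ⊔ ℓ)) where
  field
    algebra : HeytingAlgebra c ℓ₁ ℓ₂
  open HeytingAlgebra algebra public
  field
    TRUE          : Pred Carrier ℓ
    TRUE-ultra    : IsUltrafilter algebra TRUE
    f□            : Carrier → Carrier
    f□-respects   : ∀ {m m′} → m ≈ m′ → f□ m ≈ f□ m′
    cond1         : ∀ m → f□ m ≤ m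
    cond2         : ∀ m m′ m″ →
                    f□ (m ⇨ m′) ≤ (f□ (m′ ⇨ m″) ⇨ f□ (m ⇨ m″))
    cond3         : ∀ m m′ → f□ (m ∨ m′) ≤ (f□ m ∨ f□ m′)
    cond4         : ∀ m → (f□ m ∈ TRUE → m ≈ ⊤) × (m ≈ ⊤ → f□ m ∈ TRUE)

  ⟦_⟧ : Fm → (V → Carrier) → Carrier
  ⟦ var x ⟧    ε = ε x
  ⟦ ⊥ᶠ ⟧       ε = ⊥
  ⟦ φ ⇒ ψ ⟧    ε = ⟦ φ ⟧ ε ⇨ ⟦ ψ ⟧ ε
  ⟦ φ ∨ᶠ ψ ⟧   ε = ⟦ φ ⟧ ε ∨ ⟦ ψ ⟧ ε
  ⟦ φ ∧ᶠ ψ ⟧   ε = ⟦ φ ⟧ ε ∧ ⟦ ψ ⟧ ε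
  ⟦ □ φ ⟧      ε = f□ (⟦ φ ⟧ ε)

_,_⊨_ : ∀ {c ℓ₁ ℓ₂ ℓ} (M : Model c ℓ₁ ℓ₂ ℓ) → (V → Model.Carrier M) → Fm → Set ℓ
M , ε ⊨ φ = Model.⟦_⟧ M φ ε ∈ Model.TRUE M

-- The model is the Lindenbaum algebra of IPC with □φ interpreted as ⊤ if
-- ⊢ φ and ⊥ otherwise, and TRUE the classical valuation making every
-- variable false.  Condition (3) is then exactly the disjunction property
-- of IPC, and defining □ at all needs IPC to be decidable.  Both follow
-- from a terminating proof search over subformulas which returns, for a
-- sequent Γ ⇒ Δ, either a derivation of Γ ⊢ ⋁ Δ or a finite Kripke tree
-- forcing Γ and refuting Δ; two countermodels to A and to B glued under a
-- common root refute A ∨ B.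

module Submission where

open import Defs
open import Level using (0ℓ)
open import Data.Nat using (ℕ; zero; suc; _≤_; _<_; z≤n; s≤s)
open import Data.Nat.Properties using (≤-pred; <-≤-trans; m≤n⇒m≤1+n)
import Data.Nat as ℕ
open import Data.Empty using (⊥; ⊥-elim)
open import Data.Unit using (⊤; tt)
open import Data.Product using (Σ; ∃; _×_; _,_; proj₁; proj₂)
import Data.Product as Prod
open import Data.Sum using (_⊎_; inj₁; inj₂; [_,_]′)
import Data.Sum as Sum
open import Data.Sum.Effectful.Left using (applicative)
open import Data.List using (List; []; _∷_; [_]; _++_; length)
open import Data.List.Relation.Unary.Any using (here; there)
open import Data.List.Relation.Unary.All using (All; []; _∷_; lookup; tabulate; sequenceA)
import Data.List.Relation.Unary.All as All
open import Data.List.Relation.Unary.All.Properties using (++⁺)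
open import Data.List.Membership.Propositional using (_∈_; _∉_)
open import Data.List.Membership.Propositional.Properties using (∈-++⁻)
open import Data.List.Relation.Binary.Subset.Propositional using (_⊆_)
open import Data.List.Relation.Binary.Subset.Propositional.Properties
  using (∷⁺ʳ; ∈-∷⁺ʳ; xs⊆x∷xs; xs⊆xs++ys; xs⊆ys++xs)
open import Relation.Nullary using (¬_; Dec; yes; no; contradiction)
open import Relation.Nullary.Decidable using (map′; _×-dec_; _⊎-dec_; _→-dec_)
open import Relation.Binary.PropositionalEquality using (_≡_; refl; cong; cong₂; sym; subst)
open import Relation.Binary.Lattice.Bundles using (HeytingAlgebra)
open import Function using (_∘_)

infix 4 _≟_

_≟_ : (φ ψ : Fm₀) → Dec (φ ≡ ψ)
var x ≟ var y = map′ (cong var) (λ { refl → refl }) (x ℕ.≟ y)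
⊥ᶠ ≟ ⊥ᶠ = yes refl
(A ⇒ B) ≟ (C ⇒ D) = map′ (Prod.uncurry (cong₂ _⇒_)) (λ { refl → refl , refl }) (A ≟ C ×-dec B ≟ D)
(A ∨ᶠ B) ≟ (C ∨ᶠ D) = map′ (Prod.uncurry (cong₂ _∨ᶠ_)) (λ { refl → refl , refl }) (A ≟ C ×-dec B ≟ D)
(A ∧ᶠ B) ≟ (C ∧ᶠ D) = map′ (Prod.uncurry (cong₂ _∧ᶠ_)) (λ { refl → refl , refl }) (A ≟ C ×-dec B ≟ D)
var _ ≟ ⊥ᶠ = no λ ()
var _ ≟ (_ ⇒ _) = no λ ()
var _ ≟ (_ ∨ᶠ _) = no λ ()
var _ ≟ (_ ∧ᶠ _) = no λ ()
⊥ᶠ ≟ var _ = no λ ()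
⊥ᶠ ≟ (_ ⇒ _) = no λ ()
⊥ᶠ ≟ (_ ∨ᶠ _) = no λ ()
⊥ᶠ ≟ (_ ∧ᶠ _) = no λ ()
(_ ⇒ _) ≟ var _ = no λ ()
(_ ⇒ _) ≟ ⊥ᶠ = no λ ()
(_ ⇒ _) ≟ (_ ∨ᶠ _) = no λ ()
(_ ⇒ _) ≟ (_ ∧ᶠ _) = no λ ()
(_ ∨ᶠ _) ≟ var _ = no λ ()
(_ ∨ᶠ _) ≟ ⊥ᶠ = no λ ()
(_ ∨ᶠ _) ≟ (_ ⇒ _) = no λ ()
(_ ∨ᶠ _) ≟ (_ ∧ᶠ _) = no λ ()
(_ ∧ᶠ _) ≟ var _ = no λ ()
(_ ∧ᶠ _) ≟ ⊥ᶠ = no λ ()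
(_ ∧ᶠ _) ≟ (_ ⇒ _) = no λ ()
(_ ∧ᶠ _) ≟ (_ ∨ᶠ _) = no λ ()

open import Data.List.Membership.DecPropositional _≟_ using (_∈?_)

infix 2 _⊢_

data _⊢_ (Γ : List Fm₀) : Fm₀ → Set where
  hyp : ∀ {A} → A ∈ Γ → Γ ⊢ A
  ⇒I  : ∀ {A B} → A ∷ Γ ⊢ B → Γ ⊢ A ⇒ B
  ⇒E  : ∀ {A B} → Γ ⊢ A ⇒ B → Γ ⊢ A → Γ ⊢ B
  ∧I  : ∀ {A B} → Γ ⊢ A → Γ ⊢ B → Γ ⊢ A ∧ᶠ B
  ∧E₁ : ∀ {A B} → Γ ⊢ A ∧ᶠ B → Γ ⊢ A
  ∧E₂ : ∀ {A B} → Γ ⊢ A ∧ᶠ B → Γ ⊢ B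
  ∨I₁ : ∀ {A B} → Γ ⊢ A → Γ ⊢ A ∨ᶠ B
  ∨I₂ : ∀ {A B} → Γ ⊢ B → Γ ⊢ A ∨ᶠ B
  ∨E  : ∀ {A B C} → Γ ⊢ A ∨ᶠ B → A ∷ Γ ⊢ C → B ∷ Γ ⊢ C → Γ ⊢ C
  ⊥E  : ∀ {A} → Γ ⊢ ⊥ᶠ → Γ ⊢ A

#0 : ∀ {Γ A} → A ∷ Γ ⊢ A
#0 = hyp (here refl)

#1 : ∀ {Γ A B} → B ∷ A ∷ Γ ⊢ A
#1 = hyp (there (here refl))

#2 : ∀ {Γ A B C} → C ∷ B ∷ A ∷ Γ ⊢ A
#2 = hyp (there (there (here refl)))

weaken : ∀ {Γ Δ A} → Γ ⊆ Δ → Γ ⊢ A → Δ ⊢ A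
weaken s (hyp a) = hyp (s a)
weaken s (⇒I d) = ⇒I (weaken (∷⁺ʳ _ s) d)
weaken s (⇒E d e) = ⇒E (weaken s d) (weaken s e)
weaken s (∧I d e) = ∧I (weaken s d) (weaken s e)
weaken s (∧E₁ d) = ∧E₁ (weaken s d)
weaken s (∧E₂ d) = ∧E₂ (weaken s d)
weaken s (∨I₁ d) = ∨I₁ (weaken s d)
weaken s (∨I₂ d) = ∨I₂ (weaken s d)
weaken s (∨E d e f) = ∨E (weaken s d) (weaken (∷⁺ʳ _ s) e) (weaken (∷⁺ʳ _ s) f)
weaken s (⊥E d) = ⊥E (weaken s d)

weaken-closed : ∀ {Γ A} → [] ⊢ A → Γ ⊢ A
weaken-closed = weaken λ ()

cut : ∀ {Γ A B} → Γ ⊢ A → A ∷ Γ ⊢ B → Γ ⊢ B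
cut a d = ⇒E (⇒I d) a

⊢IPC⇒⊢ : ∀ {φ} → ⊢IPC φ → [] ⊢ φ
⊢IPC⇒⊢ ax-K = ⇒I (⇒I #1)
⊢IPC⇒⊢ ax-S = ⇒I (⇒I (⇒I (⇒E (⇒E #2 #0) (⇒E #1 #0))))
⊢IPC⇒⊢ ax-∧I = ⇒I (⇒I (∧I #1 #0))
⊢IPC⇒⊢ ax-∧E₁ = ⇒I (∧E₁ #0)
⊢IPC⇒⊢ ax-∧E₂ = ⇒I (∧E₂ #0)
⊢IPC⇒⊢ ax-∨I₁ = ⇒I (∨I₁ #0)
⊢IPC⇒⊢ ax-∨I₂ = ⇒I (∨I₂ #0)
⊢IPC⇒⊢ ax-∨E = ⇒I (⇒I (⇒I (∨E #0 (⇒E (weaken there #2) #0) (⇒E #2 #0))))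
⊢IPC⇒⊢ ax-⊥E = ⇒I (⊥E #0)
⊢IPC⇒⊢ (mp d e) = ⇒E (⊢IPC⇒⊢ d) (⊢IPC⇒⊢ e)

infix 2 _⊢ᴴ_

data _⊢ᴴ_ (Γ : List Fm₀) : Fm₀ → Set where
  hyp : ∀ {A} → A ∈ Γ → Γ ⊢ᴴ A
  ax  : ∀ {A} → ⊢IPC A → Γ ⊢ᴴ A
  mp  : ∀ {A B} → Γ ⊢ᴴ A ⇒ B → Γ ⊢ᴴ A → Γ ⊢ᴴ B

⊢IPC-id : ∀ {A} → ⊢IPC A ⇒ A
⊢IPC-id {A} = mp (mp (ax-S {A} {A ⇒ A} {A}) ax-K) (ax-K {A} {A})

deduction : ∀ {Γ A B} → A ∷ Γ ⊢ᴴ B → Γ ⊢ᴴ A ⇒ B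
deduction (hyp (here refl)) = ax ⊢IPC-id
deduction (hyp (there a)) = mp (ax ax-K) (hyp a)
deduction (ax p) = mp (ax ax-K) (ax p)
deduction (mp d e) = mp (mp (ax ax-S) (deduction d)) (deduction e)

⊢⇒⊢ᴴ : ∀ {Γ A} → Γ ⊢ A → Γ ⊢ᴴ A
⊢⇒⊢ᴴ (hyp a) = hyp a
⊢⇒⊢ᴴ (⇒I d) = deduction (⊢⇒⊢ᴴ d)
⊢⇒⊢ᴴ (⇒E d e) = mp (⊢⇒⊢ᴴ d) (⊢⇒⊢ᴴ e)
⊢⇒⊢ᴴ (∧I d e) = mp (mp (ax ax-∧I) (⊢⇒⊢ᴴ d)) (⊢⇒⊢ᴴ e)
⊢⇒⊢ᴴ (∧E₁ d) = mp (ax ax-∧E₁) (⊢⇒⊢ᴴ d)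
⊢⇒⊢ᴴ (∧E₂ d) = mp (ax ax-∧E₂) (⊢⇒⊢ᴴ d)
⊢⇒⊢ᴴ (∨I₁ d) = mp (ax ax-∨I₁) (⊢⇒⊢ᴴ d)
⊢⇒⊢ᴴ (∨I₂ d) = mp (ax ax-∨I₂) (⊢⇒⊢ᴴ d)
⊢⇒⊢ᴴ (∨E d e f) =
  mp (mp (mp (ax ax-∨E) (deduction (⊢⇒⊢ᴴ e))) (deduction (⊢⇒⊢ᴴ f))) (⊢⇒⊢ᴴ d)
⊢⇒⊢ᴴ (⊥E d) = mp (ax ax-⊥E) (⊢⇒⊢ᴴ d)

⊢ᴴ-closed⇒⊢IPC : ∀ {A} → [] ⊢ᴴ A → ⊢IPC A
⊢ᴴ-closed⇒⊢IPC (ax p) = p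
⊢ᴴ-closed⇒⊢IPC (mp d e) = mp (⊢ᴴ-closed⇒⊢IPC d) (⊢ᴴ-closed⇒⊢IPC e)

⊢⇒⊢IPC : ∀ {A} → [] ⊢ A → ⊢IPC A
⊢⇒⊢IPC = ⊢ᴴ-closed⇒⊢IPC ∘ ⊢⇒⊢ᴴ

-- Finite Kripke models: a world is a node of a finite tree, its successors
-- are its descendants, and the label of a node lists the variables
-- (as formulas) it makes true.
data Tree : Set where
  node : List Fm₀ → List Tree → Tree

label : Tree → List Fm₀
label (node Γ _) = Γ

leaf : Tree
leaf = node [] []

infix 4 _≼_

data _≼_ : Tree → Tree → Set where
  ≼-refl  : ∀ {t} → t ≼ t
  ≼-child : ∀ {Γ ts t s} → t ∈ ts → t ≼ s → node Γ ts ≼ s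

≼-trans : ∀ {r s t} → r ≼ s → s ≼ t → r ≼ t
≼-trans ≼-refl q = q
≼-trans (≼-child c p) q = ≼-child c (≼-trans p q)

infix 4 _⊩_ _⊩*_

_⊩_ : Tree → Fm₀ → Set
t ⊩ var x = ∀ {s} → t ≼ s → var x ∈ label s
t ⊩ ⊥ᶠ = ⊥
t ⊩ A ⇒ B = ∀ {s} → t ≼ s → s ⊩ A → s ⊩ B
t ⊩ A ∨ᶠ B = t ⊩ A ⊎ t ⊩ B
t ⊩ A ∧ᶠ B = t ⊩ A × t ⊩ B

_⊩*_ : Tree → List Fm₀ → Set
t ⊩* Γ = All (t ⊩_) Γ

⊩-mono : ∀ {t s} A → t ≼ s → t ⊩ A → s ⊩ A
⊩-mono (var x) p f q = f (≼-trans p q)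
⊩-mono (A ⇒ B) p f q = f (≼-trans p q)
⊩-mono (A ∨ᶠ B) p = Sum.map (⊩-mono A p) (⊩-mono B p)
⊩-mono (A ∧ᶠ B) p = Prod.map (⊩-mono A p) (⊩-mono B p)

⊩*-mono : ∀ {t s Γ} → t ≼ s → t ⊩* Γ → s ⊩* Γ
⊩*-mono p = All.map (⊩-mono _ p)

sound : ∀ {Γ A t} → Γ ⊢ A → t ⊩* Γ → t ⊩ A
sound (hyp a) g = lookup g a
sound (⇒I d) g p a = sound d (a ∷ ⊩*-mono p g)
sound (⇒E d e) g = sound d g ≼-refl (sound e g)
sound (∧I d e) g = sound d g , sound e g
sound (∧E₁ d) g = proj₁ (sound d g)
sound (∧E₂ d) g = proj₂ (sound d g)
sound (∨I₁ d) g = inj₁ (sound d g)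
sound (∨I₂ d) g = inj₂ (sound d g)
sound (∨E d e f) g = [ (λ a → sound e (a ∷ g)) , (λ b → sound f (b ∷ g)) ]′ (sound d g)
sound (⊥E d) g = ⊥-elim (sound d g)

⊩-leaf-⇒ : ∀ {A B} → (leaf ⊩ A → leaf ⊩ B) → leaf ⊩ A ⇒ B
⊩-leaf-⇒ f ≼-refl = f
⊩-leaf-⇒ f (≼-child () _)

leaf-⊩? : ∀ A → Dec (leaf ⊩ A)
leaf-⊩? (var x) = no λ f → contradiction (f ≼-refl) λ ()
leaf-⊩? ⊥ᶠ = no λ ()
leaf-⊩? (A ⇒ B) = map′ ⊩-leaf-⇒ (λ f → f ≼-refl) (leaf-⊩? A →-dec leaf-⊩? B)
leaf-⊩? (A ∨ᶠ B) = leaf-⊩? A ⊎-dec leaf-⊩? B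
leaf-⊩? (A ∧ᶠ B) = leaf-⊩? A ×-dec leaf-⊩? B

⋁ : List Fm₀ → Fm₀
⋁ [] = ⊥ᶠ
⋁ (D ∷ Δ) = D ∨ᶠ ⋁ Δ

⋁-intro : ∀ {Γ Δ D} → D ∈ Δ → Γ ⊢ D → Γ ⊢ ⋁ Δ
⋁-intro (here refl) d = ∨I₁ d
⋁-intro (there m) d = ∨I₂ (⋁-intro m d)

Countermodel : List Fm₀ → List Fm₀ → Set
Countermodel Γ Δ = ∃ λ t → t ⊩* Γ × All (λ D → ¬ t ⊩ D) Δ

Decided : List Fm₀ → List Fm₀ → Set
Decided Γ Δ = (Γ ⊢ ⋁ Δ) ⊎ Countermodel Γ Δ

module _ {Γ Δ : List Fm₀} {A B : Fm₀} where

  ∧-left : A ∧ᶠ B ∈ Γ → Decided (A ∷ B ∷ Γ) Δ → Decided Γ Δ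
  ∧-left m (inj₁ d) = inj₁ (cut (∧E₂ (hyp m)) (cut (∧E₁ (hyp (there m))) d))
  ∧-left m (inj₂ (t , _ ∷ _ ∷ g , r)) = inj₂ (t , g , r)

  ∨-left : A ∨ᶠ B ∈ Γ → Decided (A ∷ Γ) Δ → Decided (B ∷ Γ) Δ → Decided Γ Δ
  ∨-left m (inj₁ d) (inj₁ e) = inj₁ (∨E (hyp m) d e)
  ∨-left m (inj₂ (t , _ ∷ g , r)) _ = inj₂ (t , g , r)
  ∨-left m (inj₁ _) (inj₂ (t , _ ∷ g , r)) = inj₂ (t , g , r)

  ⇒-left : A ⇒ B ∈ Γ → Decided Γ (A ∷ Δ) → Decided (B ∷ Γ) Δ → Decided Γ Δ
  ⇒-left m (inj₁ d) (inj₁ e) =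
    inj₁ (∨E d (cut (⇒E (hyp (there m)) #0) (weaken (∷⁺ʳ _ (xs⊆x∷xs _ _)) e)) #0)
  ⇒-left m (inj₂ (t , g , _ ∷ r)) _ = inj₂ (t , g , r)
  ⇒-left m (inj₁ _) (inj₂ (t , _ ∷ g , r)) = inj₂ (t , g , r)

  ∧-right : A ∧ᶠ B ∈ Δ → Decided Γ (A ∷ Δ) → Decided Γ (B ∷ Δ) → Decided Γ Δ
  ∧-right m (inj₁ d) (inj₁ e) = inj₁ (∨E d (∨E (weaken there e) (⋁-intro m (∧I #1 #0)) #0) #0)
  ∧-right m (inj₂ (t , g , _ ∷ r)) _ = inj₂ (t , g , r)
  ∧-right m (inj₁ _) (inj₂ (t , g , _ ∷ r)) = inj₂ (t , g , r)

  ∨-right : A ∨ᶠ B ∈ Δ → Decided Γ (A ∷ B ∷ Δ) → Decided Γ Δ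
  ∨-right m (inj₁ d) = inj₁ (∨E d (⋁-intro m (∨I₁ #0)) (∨E #0 (⋁-intro m (∨I₂ #0)) #0))
  ∨-right m (inj₂ (t , g , _ ∷ _ ∷ r)) = inj₂ (t , g , r)

  ⇒-right : A ⇒ B ∈ Δ → Decided Γ (B ∷ Δ) → Decided Γ Δ
  ⇒-right m (inj₁ d) = inj₁ (∨E d (⋁-intro m (⇒I #1)) #0)
  ⇒-right m (inj₂ (t , g , _ ∷ r)) = inj₂ (t , g , r)

-- Γ ⇒ Δ is saturated when no invertible rule above adds a new formula.
SaturatedL : List Fm₀ → List Fm₀ → Fm₀ → Set
SaturatedL Γ Δ (var x) = var x ∉ Δ
SaturatedL Γ Δ ⊥ᶠ = ⊥
SaturatedL Γ Δ (A ⇒ B) = A ∈ Δ ⊎ B ∈ Γ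
SaturatedL Γ Δ (A ∨ᶠ B) = A ∈ Γ ⊎ B ∈ Γ
SaturatedL Γ Δ (A ∧ᶠ B) = A ∈ Γ × B ∈ Γ

SaturatedR : List Fm₀ → List Fm₀ → Fm₀ → Set
SaturatedR Γ Δ (A ⇒ B) = A ∈ Γ → B ∈ Δ
SaturatedR Γ Δ (A ∨ᶠ B) = A ∈ Δ × B ∈ Δ
SaturatedR Γ Δ (A ∧ᶠ B) = A ∈ Δ ⊎ B ∈ Δ
SaturatedR Γ Δ _ = ⊤

Witnessed : List Fm₀ → List Tree → Fm₀ → Set
Witnessed Γ ts D = ∀ {A B} → D ≡ A ⇒ B → A ∉ Γ → ∃ λ t → t ∈ ts × t ⊩ A × ¬ t ⊩ B

Witnessed-mono : ∀ {Γ ts us D} → ts ⊆ us → Witnessed Γ ts D → Witnessed Γ us D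
Witnessed-mono s w eq a∉ with w eq a∉
... | t , t∈ts , ta , ¬tb = t , s t∈ts , ta , ¬tb

Children : List Fm₀ → List Fm₀ → Set
Children Γ Δ = ∃ λ ts → All (_⊩* Γ) ts × All (Witnessed Γ ts) Δ

merge-children : ∀ {Γ Δ} →
                 All (λ D → ∃ λ ts → All (_⊩* Γ) ts × Witnessed Γ ts D) Δ → Children Γ Δ
merge-children [] = [] , [] , []
merge-children ((ts , g , w) ∷ cs) with merge-children cs
... | us , gs , ws =
  ts ++ us , ++⁺ g gs
  , Witnessed-mono (xs⊆xs++ys ts us) w ∷ All.map (Witnessed-mono (xs⊆ys++xs us ts)) ws

module SaturatedNode {Γ Δ : List Fm₀} (satL : All (SaturatedL Γ Δ) Γ)
                     (satR : All (SaturatedR Γ Δ) Δ) {ts : List Tree}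
                     (children : All (_⊩* Γ) ts) (wit : All (Witnessed Γ ts) Δ) where

  root : Tree
  root = node Γ ts

  mutual
    forces : ∀ {C} → C ∈ Γ → root ⊩ C
    forces {var x} m ≼-refl = m
    forces {var x} m (≼-child c p) = lookup (lookup children c) m p
    forces {⊥ᶠ} m = ⊥-elim (lookup satL m)
    forces {A ⇒ B} m ≼-refl a = [ (λ a∈Δ → ⊥-elim (refutes a∈Δ a)) , forces ]′ (lookup satL m)
    forces {A ⇒ B} m (≼-child c p) = lookup (lookup children c) m p
    forces {A ∨ᶠ B} m = Sum.map forces forces (lookup satL m)
    forces {A ∧ᶠ B} m = Prod.map forces forces (lookup satL m)

    refutes : ∀ {C} → C ∈ Δ → ¬ root ⊩ C
    refutes {var x} d f = lookup satL (f ≼-refl) d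
    refutes {⊥ᶠ} d f = f
    refutes {A ⇒ B} d f with A ∈? Γ
    ... | yes a = refutes (lookup satR d a) (f ≼-refl (forces a))
    ... | no a∉ with lookup wit d refl a∉
    ...   | t , t∈ts , ta , ¬tb = ¬tb (f (≼-child t∈ts ≼-refl) ta)
    refutes {A ∨ᶠ B} d = [ refutes (proj₁ (lookup satR d)) , refutes (proj₂ (lookup satR d)) ]′
    refutes {A ∧ᶠ B} d (fa , fb) = [ (λ a → refutes a fa) , (λ b → refutes b fb) ]′ (lookup satR d)

  countermodel : Countermodel Γ Δ
  countermodel = root , tabulate forces , tabulate refutes

mutual
  sub : Fm₀ → List Fm₀
  sub φ = φ ∷ proper-sub φ

  proper-sub : Fm₀ → List Fm₀
  proper-sub (var _) = []
  proper-sub ⊥ᶠ = []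
  proper-sub (A ⇒ B) = sub A ++ sub B
  proper-sub (A ∨ᶠ B) = sub A ++ sub B
  proper-sub (A ∧ᶠ B) = sub A ++ sub B

SubformulaClosed : List Fm₀ → Set
SubformulaClosed S = ∀ {C} → C ∈ S → sub C ⊆ S

mutual
  sub-closed : ∀ φ → SubformulaClosed (sub φ)
  sub-closed φ (here refl) = λ c → c
  sub-closed (A ⇒ B) (there m) = there ∘ sub-closed-++ A B m
  sub-closed (A ∨ᶠ B) (there m) = there ∘ sub-closed-++ A B m
  sub-closed (A ∧ᶠ B) (there m) = there ∘ sub-closed-++ A B m

  sub-closed-++ : ∀ A B → SubformulaClosed (sub A ++ sub B)
  sub-closed-++ A B m with ∈-++⁻ (sub A) m
  ... | inj₁ a = xs⊆xs++ys (sub A) (sub B) ∘ sub-closed A a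
  ... | inj₂ b = xs⊆ys++xs (sub B) (sub A) ∘ sub-closed B b

missing : List Fm₀ → List Fm₀ → ℕ
missing [] Γ = 0
missing (C ∷ S) Γ with C ∈? Γ
... | yes _ = missing S Γ
... | no _ = suc (missing S Γ)

missing≤length : ∀ S Γ → missing S Γ ≤ length S
missing≤length [] Γ = z≤n
missing≤length (C ∷ S) Γ with C ∈? Γ
... | yes _ = m≤n⇒m≤1+n (missing≤length S Γ)
... | no _ = s≤s (missing≤length S Γ)

missing-antitone : ∀ {Γ Γ′} → Γ ⊆ Γ′ → ∀ S → missing S Γ′ ≤ missing S Γ
missing-antitone s [] = z≤n
missing-antitone {Γ} {Γ′} s (C ∷ S) with C ∈? Γ | C ∈? Γ′
... | yes _ | yes _ = missing-antitone s S
... | yes c | no c∉ = contradiction (s c) c∉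
... | no _ | yes _ = m≤n⇒m≤1+n (missing-antitone s S)
... | no _ | no _ = s≤s (missing-antitone s S)

missing-decreases : ∀ {Γ Γ′ C S} → Γ ⊆ Γ′ → C ∈ S → C ∉ Γ → C ∈ Γ′ →
                    missing S Γ′ < missing S Γ
missing-decreases {Γ} {Γ′} {S = C ∷ S} s (here refl) c∉ c with C ∈? Γ | C ∈? Γ′
... | yes c′ | _ = contradiction c′ c∉
... | no _ | yes _ = s≤s (missing-antitone s S)
... | no _ | no c∉′ = contradiction c c∉′
missing-decreases {Γ} {Γ′} {S = D ∷ S} s (there m) c∉ c with D ∈? Γ | D ∈? Γ′
... | yes _ | yes _ = missing-decreases s m c∉ c
... | yes d | no d∉ = contradiction (s d) d∉
... | no _ | yes _ = m≤n⇒m≤1+n (missing-decreases s m c∉ c)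
... | no _ | no _ = s≤s (missing-decreases s m c∉ c)

module Search (S : List Fm₀) (closed : SubformulaClosed S) where

  components : ∀ {φ A B} → φ ∈ S → sub A ++ sub B ⊆ sub φ → A ∈ S × B ∈ S
  components {A = A} {B} m s =
    closed m (s (xs⊆xs++ys (sub A) (sub B) (here refl))) , closed m (s (xs⊆ys++xs (sub B) (sub A) (here refl)))

  -- The search only ever adds formulas of S to Γ or to Δ; it recurses on
  -- missing S Γ, and for fixed Γ on missing S Δ.
  Searchable : ℕ → ℕ → Set
  Searchable k l = ∀ {Γ Δ} → Γ ⊆ S → Δ ⊆ S → missing S Γ < k → missing S Δ < l → Decided Γ Δ

  module Step {k l} (search-Γ : Searchable k (suc (length S))) (search-Δ : Searchable (suc k) l)
              {Γ Δ} (Γ⊆S : Γ ⊆ S) (Δ⊆S : Δ ⊆ S)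
              (Γ-bound : missing S Γ < suc k) (Δ-bound : missing S Δ < suc l) where

    extendL : ∀ {Γ′ Δ′} → Γ ⊆ Γ′ → Γ′ ⊆ S → Δ′ ⊆ S → (∃ λ C → C ∈ Γ′ × C ∉ Γ) → Decided Γ′ Δ′
    extendL {Δ′ = Δ′} s Γ′⊆S Δ′⊆S (_ , c , c∉) =
      search-Γ Γ′⊆S Δ′⊆S (<-≤-trans (missing-decreases s (Γ′⊆S c) c∉ c) (≤-pred Γ-bound))
               (s≤s (missing≤length S Δ′))

    extendR : ∀ {Δ′} → Δ ⊆ Δ′ → Δ′ ⊆ S → (∃ λ C → C ∈ Δ′ × C ∉ Δ) → Decided Γ Δ′
    extendR s Δ′⊆S (_ , c , c∉) =
      search-Δ Γ⊆S Δ′⊆S Γ-bound (<-≤-trans (missing-decreases s (Δ′⊆S c) c∉ c) (≤-pred Δ-bound))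

    addL : ∀ {A Δ′} → A ∈ S → A ∉ Γ → Δ′ ⊆ S → Decided (A ∷ Γ) Δ′
    addL a a∉ Δ′⊆S = extendL (xs⊆x∷xs _ _) (∈-∷⁺ʳ a Γ⊆S) Δ′⊆S (_ , here refl , a∉)

    addL₂ : ∀ {A B} → A ∈ S → B ∈ S → A ∉ Γ ⊎ B ∉ Γ → Decided (A ∷ B ∷ Γ) Δ
    addL₂ a b new = extendL (there ∘ there) (∈-∷⁺ʳ a (∈-∷⁺ʳ b Γ⊆S)) Δ⊆S
      ([ (λ a∉ → _ , here refl , a∉) , (λ b∉ → _ , there (here refl) , b∉) ]′ new)

    addR : ∀ {A} → A ∈ S → A ∉ Δ → Decided Γ (A ∷ Δ)
    addR a a∉ = extendR (xs⊆x∷xs _ _) (∈-∷⁺ʳ a Δ⊆S) (_ , here refl , a∉)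

    addR₂ : ∀ {A B} → A ∈ S → B ∈ S → A ∉ Δ ⊎ B ∉ Δ → Decided Γ (A ∷ B ∷ Δ)
    addR₂ a b new = extendR (there ∘ there) (∈-∷⁺ʳ a (∈-∷⁺ʳ b Δ⊆S))
      ([ (λ a∉ → _ , here refl , a∉) , (λ b∉ → _ , there (here refl) , b∉) ]′ new)

    stepL : ∀ {C} → C ∈ Γ → Decided Γ Δ ⊎ SaturatedL Γ Δ C
    stepL {var x} m with var x ∈? Δ
    ... | yes d = inj₁ (inj₁ (⋁-intro d (hyp m)))
    ... | no d∉ = inj₂ d∉
    stepL {⊥ᶠ} m = inj₁ (inj₁ (⊥E (hyp m)))
    stepL {A ⇒ B} m with components (Γ⊆S m) there | A ∈? Δ | B ∈? Γ
    ... | _ | yes a | _ = inj₂ (inj₁ a)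
    ... | _ | no _ | yes b = inj₂ (inj₂ b)
    ... | a , b | no a∉ | no b∉ = inj₁ (⇒-left m (addR a a∉) (addL b b∉ Δ⊆S))
    stepL {A ∨ᶠ B} m with components (Γ⊆S m) there | A ∈? Γ | B ∈? Γ
    ... | _ | yes a | _ = inj₂ (inj₁ a)
    ... | _ | no _ | yes b = inj₂ (inj₂ b)
    ... | a , b | no a∉ | no b∉ = inj₁ (∨-left m (addL a a∉ Δ⊆S) (addL b b∉ Δ⊆S))
    stepL {A ∧ᶠ B} m with components (Γ⊆S m) there | A ∈? Γ | B ∈? Γ
    ... | _ | yes a | yes b = inj₂ (a , b)
    ... | a , b | no a∉ | _ = inj₁ (∧-left m (addL₂ a b (inj₁ a∉)))
    ... | a , b | yes _ | no b∉ = inj₁ (∧-left m (addL₂ a b (inj₂ b∉)))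

    stepR : ∀ {C} → C ∈ Δ → Decided Γ Δ ⊎ SaturatedR Γ Δ C
    stepR {var _} _ = inj₂ tt
    stepR {⊥ᶠ} _ = inj₂ tt
    stepR {A ⇒ B} m with components (Δ⊆S m) there | A ∈? Γ | B ∈? Δ
    ... | _ | no a∉ | _ = inj₂ λ a → contradiction a a∉
    ... | _ | yes _ | yes b = inj₂ λ _ → b
    ... | _ , b | yes _ | no b∉ = inj₁ (⇒-right m (addR b b∉))
    stepR {A ∨ᶠ B} m with components (Δ⊆S m) there | A ∈? Δ | B ∈? Δ
    ... | _ | yes a | yes b = inj₂ (a , b)
    ... | a , b | no a∉ | _ = inj₁ (∨-right m (addR₂ a b (inj₁ a∉)))
    ... | a , b | yes _ | no b∉ = inj₁ (∨-right m (addR₂ a b (inj₂ b∉)))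
    stepR {A ∧ᶠ B} m with components (Δ⊆S m) there | A ∈? Δ | B ∈? Δ
    ... | _ | yes a | _ = inj₂ (inj₁ a)
    ... | _ | no _ | yes b = inj₂ (inj₂ b)
    ... | a , b | no a∉ | no b∉ = inj₁ (∧-right m (addR a a∉) (addR b b∉))

    -- The non-invertible rule: for A ⇒ B ∈ Δ with A ∉ Γ the sequent A, Γ ⇒ B
    -- is searched afresh, and its countermodel becomes a child of the root.
    stepChild : ∀ {C} → C ∈ Δ → Decided Γ Δ ⊎ ∃ λ ts → All (_⊩* Γ) ts × Witnessed Γ ts C
    stepChild {var _} _ = inj₂ ([] , [] , λ ())
    stepChild {⊥ᶠ} _ = inj₂ ([] , [] , λ ())
    stepChild {_ ∨ᶠ _} _ = inj₂ ([] , [] , λ ())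
    stepChild {_ ∧ᶠ _} _ = inj₂ ([] , [] , λ ())
    stepChild {A ⇒ B} m with components (Δ⊆S m) there | A ∈? Γ
    ... | _ | yes a = inj₂ ([] , [] , λ { refl a∉ → contradiction a a∉ })
    ... | a , b | no a∉ with addL a a∉ (∈-∷⁺ʳ b λ ())
    ...   | inj₁ d = inj₁ (inj₁ (⋁-intro m (⇒I (∨E d #0 (⊥E #0)))))
    ...   | inj₂ (t , ta ∷ g , ¬tb ∷ []) = inj₂ ([ t ] , g ∷ [] , λ { refl _ → t , here refl , ta , ¬tb })

    sequence-or-stop : ∀ {P : Fm₀ → Set} {xs} →
                       All (λ x → Decided Γ Δ ⊎ P x) xs → Decided Γ Δ ⊎ All P xs
    sequence-or-stop = sequenceA 0ℓ (applicative (Decided Γ Δ) 0ℓ)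

    decided : Decided Γ Δ
    decided with sequence-or-stop (tabulate stepL)
    ... | inj₁ r = r
    ... | inj₂ satL with sequence-or-stop (tabulate stepR)
    ...   | inj₁ r = r
    ...   | inj₂ satR with sequence-or-stop (tabulate stepChild)
    ...     | inj₁ r = r
    ...     | inj₂ cs = let _ , children , wit = merge-children cs
                        in inj₂ (SaturatedNode.countermodel satL satR children wit)

  search : ∀ k l → Searchable k l
  search zero _ _ _ () _
  search (suc k) zero _ _ _ ()
  search (suc k) (suc l) = Step.decided (search k (suc (length S))) (search (suc k) l)

  decide : ∀ {Γ Δ} → Γ ⊆ S → Δ ⊆ S → Decided Γ Δ
  decide {Γ} {Δ} Γ⊆S Δ⊆S = search (suc (length S)) (suc (length S)) Γ⊆S Δ⊆S
                                  (s≤s (missing≤length S Γ)) (s≤s (missing≤length S Δ))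

-- Opaque, so that type checking never unfolds the search on open terms.
opaque
  proof-or-countermodel : ∀ φ → ([] ⊢ φ) ⊎ (∃ λ t → ¬ t ⊩ φ)
  proof-or-countermodel φ
    with Search.decide (sub φ) (sub-closed φ) (λ ()) (∈-∷⁺ʳ (here refl) λ ())
  ... | inj₁ d = inj₁ (∨E d #0 (⊥E #0))
  ... | inj₂ (t , _ , ¬tφ ∷ []) = inj₂ (t , ¬tφ)

provable? : ∀ φ → Dec ([] ⊢ φ)
provable? φ with proof-or-countermodel φ
... | inj₁ d = yes d
... | inj₂ (t , ¬tφ) = no λ d → ¬tφ (sound d [])

disjunction-property : ∀ {A B} → [] ⊢ A ∨ᶠ B → ([] ⊢ A) ⊎ ([] ⊢ B)
disjunction-property {A} {B} d with proof-or-countermodel A | proof-or-countermodel B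
... | inj₁ a | _ = inj₁ a
... | inj₂ _ | inj₁ b = inj₂ b
... | inj₂ (t , ¬tA) | inj₂ (s , ¬sB) =
  [ (λ a → ⊥-elim (¬tA (⊩-mono A (≼-child (here refl) ≼-refl) a)))
  , (λ b → ⊥-elim (¬sB (⊩-mono B (≼-child (there (here refl)) ≼-refl) b))) ]′
  (sound {t = node [] (t ∷ s ∷ [])} d [])

infix 4 _≤ᴸ_ _≈ᴸ_

_≤ᴸ_ : Fm₀ → Fm₀ → Set
A ≤ᴸ B = [] ⊢ A ⇒ B

_≈ᴸ_ : Fm₀ → Fm₀ → Set
A ≈ᴸ B = A ≤ᴸ B × B ≤ᴸ A

⊤ᴸ : Fm₀
⊤ᴸ = ⊥ᶠ ⇒ ⊥ᶠ

≤ᴸ-refl : ∀ {A} → A ≤ᴸ A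
≤ᴸ-refl = ⇒I #0

≤ᴸ-trans : ∀ {A B C} → A ≤ᴸ B → B ≤ᴸ C → A ≤ᴸ C
≤ᴸ-trans p q = ⇒I (⇒E (weaken-closed q) (⇒E (weaken-closed p) #0))

≤ᴸ-provable : ∀ {A B} → [] ⊢ B → A ≤ᴸ B
≤ᴸ-provable b = ⇒I (weaken-closed b)

⇒-precompose : ∀ {A B C} → A ≤ᴸ B → (B ⇒ C) ≤ᴸ (A ⇒ C)
⇒-precompose p = ⇒I (⇒I (⇒E #1 (⇒E (weaken-closed p) #0)))

⊥≤ᴸ : ∀ {A} → ⊥ᶠ ≤ᴸ A
⊥≤ᴸ = ⇒I (⊥E #0)

≈ᴸ⊤⇒provable : ∀ {A} → A ≈ᴸ ⊤ᴸ → [] ⊢ A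
≈ᴸ⊤⇒provable (_ , p) = ⇒E p ≤ᴸ-refl

provable⇒≈ᴸ⊤ : ∀ {A} → [] ⊢ A → A ≈ᴸ ⊤ᴸ
provable⇒≈ᴸ⊤ a = ≤ᴸ-provable ≤ᴸ-refl , ≤ᴸ-provable a

lindenbaum : HeytingAlgebra 0ℓ 0ℓ 0ℓ
lindenbaum = record
  { Carrier = Fm₀ ; _≈_ = _≈ᴸ_ ; _≤_ = _≤ᴸ_ ; _∨_ = _∨ᶠ_ ; _∧_ = _∧ᶠ_ ; _⇨_ = _⇒_
  ; ⊤ = ⊤ᴸ ; ⊥ = ⊥ᶠ
  ; isHeytingAlgebra = record
    { isBoundedLattice = record
      { isLattice = record
        { isPartialOrder = record
          { isPreorder = record
            { isEquivalence = record
              { refl = ≤ᴸ-refl , ≤ᴸ-refl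
              ; sym = λ (p , q) → q , p
              ; trans = λ (p , q) (p′ , q′) → ≤ᴸ-trans p p′ , ≤ᴸ-trans q′ q }
            ; reflexive = proj₁
            ; trans = ≤ᴸ-trans }
          ; antisym = _,_ }
        ; supremum = λ _ _ → ⇒I (∨I₁ #0) , ⇒I (∨I₂ #0) ,
                     λ _ p q → ⇒I (∨E #0 (⇒E (weaken-closed p) #0) (⇒E (weaken-closed q) #0))
        ; infimum = λ _ _ → ⇒I (∧E₁ #0) , ⇒I (∧E₂ #0) ,
                    λ _ p q → ⇒I (∧I (⇒E (weaken-closed p) #0) (⇒E (weaken-closed q) #0)) }
      ; maximum = λ _ → ≤ᴸ-provable ≤ᴸ-refl
      ; minimum = λ _ → ⊥≤ᴸ }
    ; exponential = λ _ _ _ →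
        (λ p → ⇒I (⇒I (⇒E (weaken-closed p) (∧I #1 #0)))) ,
        (λ p → ⇒I (⇒E (⇒E (weaken-closed p) (∧E₁ #0)) (∧E₂ #0))) } }

-- The one-point Kripke model is the classical valuation making every variable false.
leaf-ultrafilter : IsUltrafilter lindenbaum (leaf ⊩_)
leaf-ultrafilter = record
  { isFilter = record
    { nonEmpty = ⊤ᴸ , λ _ f → f
    ; upClosed = λ p a → sound p [] ≼-refl a
    ; ∧-closed = _,_
    ; ⊥∉ = λ () }
  ; maximal = maximal }
  where
  -- A filter containing TRUE and some A false at the leaf contains ¬ A,
  -- hence A ∧ ¬ A ≤ ⊥.
  maximal : ∀ G → IsFilter lindenbaum G → (∀ {A} → leaf ⊩ A → G A) → ∀ {A} → G A → leaf ⊩ A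
  maximal G G-filter leaf⊆G {A} A∈G with leaf-⊩? A
  ... | yes a = a
  ... | no ¬a = ⊥-elim (⊥∉ (upClosed (⇒I (⇒E (∧E₂ #0) (∧E₁ #0)))
                                    (∧-closed A∈G (leaf⊆G {A ⇒ ⊥ᶠ} (⊩-leaf-⇒ ¬a)))))
    where open IsFilter G-filter

□ᴸ : Fm₀ → Fm₀
□ᴸ A with provable? A
... | yes _ = ⊤ᴸ
... | no _ = ⊥ᶠ

□ᴸ-intro : ∀ {A} → [] ⊢ A → [] ⊢ □ᴸ A
□ᴸ-intro {A} a with provable? A
... | yes _ = ≤ᴸ-refl
... | no ¬a = contradiction a ¬a

□ᴸ-reflect : ∀ {A} → leaf ⊩ □ᴸ A → [] ⊢ A
□ᴸ-reflect {A} t with provable? A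
... | yes a = a
... | no _ = ⊥-elim t

□ᴸ-mono : ∀ {A B} → A ≤ᴸ B → □ᴸ A ≤ᴸ □ᴸ B
□ᴸ-mono {A} p with provable? A
... | yes a = ≤ᴸ-provable (□ᴸ-intro (⇒E p a))
... | no _ = ⊥≤ᴸ

□ᴸ-deflationary : ∀ A → □ᴸ A ≤ᴸ A
□ᴸ-deflationary A with provable? A
... | yes a = ≤ᴸ-provable a
... | no _ = ⊥≤ᴸ

□ᴸ-transitivity : ∀ A B C → □ᴸ (A ⇒ B) ≤ᴸ (□ᴸ (B ⇒ C) ⇒ □ᴸ (A ⇒ C))
□ᴸ-transitivity A B C with provable? (A ⇒ B)
... | no _ = ⊥≤ᴸ
... | yes p = ≤ᴸ-provable (□ᴸ-mono (⇒-precompose p))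

□ᴸ-disjunction : ∀ A B → □ᴸ (A ∨ᶠ B) ≤ᴸ (□ᴸ A ∨ᶠ □ᴸ B)
□ᴸ-disjunction A B with provable? (A ∨ᶠ B)
... | no _ = ⊥≤ᴸ
... | yes p = ≤ᴸ-provable ([ ∨I₁ ∘ □ᴸ-intro , ∨I₂ ∘ □ᴸ-intro ]′ (disjunction-property p))

lindenbaum-model : Model 0ℓ 0ℓ 0ℓ 0ℓ
lindenbaum-model = record
  { algebra = lindenbaum
  ; TRUE = leaf ⊩_
  ; TRUE-ultra = leaf-ultrafilter
  ; f□ = □ᴸ
  ; f□-respects = λ (p , q) → □ᴸ-mono p , □ᴸ-mono q
  ; cond1 = □ᴸ-deflationary
  ; cond2 = □ᴸ-transitivity
  ; cond3 = □ᴸ-disjunction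
  ; cond4 = λ _ → provable⇒≈ᴸ⊤ ∘ □ᴸ-reflect
                , λ A≈⊤ → sound (□ᴸ-intro (≈ᴸ⊤⇒provable A≈⊤)) [] }

⟦⌜⌝⟧-var : ∀ φ → Model.⟦_⟧ lindenbaum-model ⌜ φ ⌝ var ≡ φ
⟦⌜⌝⟧-var (var x) = refl
⟦⌜⌝⟧-var ⊥ᶠ = refl
⟦⌜⌝⟧-var (A ⇒ B) = cong₂ _⇒_ (⟦⌜⌝⟧-var A) (⟦⌜⌝⟧-var B)
⟦⌜⌝⟧-var (A ∨ᶠ B) = cong₂ _∨ᶠ_ (⟦⌜⌝⟧-var A) (⟦⌜⌝⟧-var B)
⟦⌜⌝⟧-var (A ∧ᶠ B) = cong₂ _∧ᶠ_ (⟦⌜⌝⟧-var A) (⟦⌜⌝⟧-var B)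

corollary5p4 : Σ (Model 0ℓ 0ℓ 0ℓ 0ℓ) λ M → Σ (V → Model.Carrier M) λ ε →
    ∀ (φ : Fm₀) → (M , ε ⊨ (□ ⌜ φ ⌝) → ⊢IPC φ) × (⊢IPC φ → M , ε ⊨ (□ ⌜ φ ⌝))
corollary5p4 = lindenbaum-model , var , λ φ →
    (λ h → ⊢⇒⊢IPC (□ᴸ-reflect (subst (λ A → leaf ⊩ □ᴸ A) (⟦⌜⌝⟧-var φ) h)))
  , (λ p → subst (λ A → leaf ⊩ □ᴸ A) (sym (⟦⌜⌝⟧-var φ)) (sound (□ᴸ-intro (⊢IPC⇒⊢ p)) []))
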